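{- There is a valid $(m, 1)$ protocol that accepts any valid list of label-augmented edges.
   Context: Setting (annotation model): a verifier $\mathcal{V}$ with a private random string and small working memory, and a deterministic helper $\mathcal{H}$, both observe a data stream $\mathcal{A}$; after the stream ends, $\mathcal{H}$ sends an annotation $h(\mathcal{A})$, which $\mathcal{V}$ also reads as a stream (one-way access to $\mathcal{A}\cdot h$). $\mathcal{V}$ may output $\perp$ if unconvinced. A protocol is valid if (1) there is at least one helper whose annotation makes $\mathcal{V}$ output the correct answer (or accept) with probability 1 on every stream, and (2) for every helper and every stream, either that helper's annotation is valid for the stream or $\mathcal{V}$ outputs something other than $\perp$ with probability at most $1/3$. An $(h,v)$ protocol is a valid protocol whose annotation length (help cost) is $O(h+1)$ and whose verifier working memory (verification cost) is $O(v+1)$, both measured in machine words of $\Theta(\log m)$ bits. The stream is a graph stream of $m$ edges $e_i\in[n]\times[n]$ defining a (multi)graph $G=(V,E)$. A list of edges $E'$ is label-augmented if (a) $E'$ is preceded by a sorted list of all nodes $v\in V$, each with a value $l(v)$ (its label) and a value $\deg(v)$ claimed to be the degree of $v$; and (b) each edge $e=(u,v)$ in $E'$ is annotated with a pair of symbols $l(e,u)$ and $l(e,v)$. A list of label-augmented edges $E'$ is valid if for all edges $e=(u,v)$, $l(e,u)=l(u)$ and $l(e,v)=l(v)$, and $E'=E$, where $E$ is the set of edges observed in the stream. -}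

module Defs where

open import Data.Nat using (ℕ; _+_; _*_; _^_; _≤_)
open import Data.Bool using (Bool; true; false; if_then_else_)
open import Data.Fin using (Fin; _<_; _≟_)
open import Data.List using (List; []; _∷_; map; foldl; allFin; _++_; length)
open import Data.Nat.ListAction using (sum)
open import Data.List.Membership.Propositional using (_∈_)
open import Data.List.Relation.Unary.All using (All)
open import Data.List.Relation.Unary.Any using (Any)
open import Data.List.Relation.Unary.Linked using (Linked)
open import Data.List.Relation.Binary.Permutation.Propositional using (_↭_)
open import Data.Product using (Σ; _×_; _,_; proj₁; proj₂)
open import Data.Sum using (_⊎_)
open import Relation.Nullary using (¬_)
open import Relation.Nullary.Decidable using (⌊_⌋)
open import Relation.Binary.PropositionalEquality using (_≡_)

Edge : ℕ → Set
Edge n = Fin n × Fin n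

-- Header entry of a label-augmented list: node v, its label l(v), claimed degree deg(v).
NodeEntry : ℕ → ℕ → Set
NodeEntry n L = Fin n × Fin L × ℕ

-- Label-augmented edge (u , v , l(e,u) , l(e,v)).
AugEdge : ℕ → ℕ → Set
AugEdge n L = Fin n × Fin n × Fin L × Fin L

data Tok (n L : ℕ) : Set where
  nodeT : Fin n → Fin L → ℕ → Tok n L
  edgeT : Fin n → Fin n → Fin L → Fin L → Tok n L

nodeTok : ∀ {n L} → NodeEntry n L → Tok n L
nodeTok (v , l , d) = nodeT v l d

edgeTok : ∀ {n L} → AugEdge n L → Tok n L
edgeTok (u , v , lu , lv) = edgeT u v lu lv

-- A streaming verifier with a private random string r ∈ Fin R, working memory
-- with S possible states, one-way access to the stream A followed by the annotation h.
record Verifier (n L : ℕ) : Set where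
  field
    S     : ℕ
    R     : ℕ
    init  : Fin R → Fin S
    stepA : Fin R → Fin S → Edge n → Fin S
    stepH : Fin R → Fin S → Tok n L → Fin S
    out   : Fin S → Bool      -- true = accept, false = ⊥

module _ {n L : ℕ} (V : Verifier n L) where
  open Verifier V

  run : Fin R → List (Edge n) → List (Tok n L) → Bool
  run r A h = out (foldl (stepH r) (foldl (stepA r) (init r) A) h)

  -- number of random strings on which V accepts (probability = acceptCount / R)
  acceptCount : List (Edge n) → List (Tok n L) → ℕ
  acceptCount A h = sum (map (λ r → if run r A h then 1 else 0) (allFin R))

-- degree of v in the multigraph given by the stream (a self loop counts twice)
degree : ∀ {n} → List (Edge n) → Fin n → ℕ
degree A v = sum (map (λ e → (if ⌊ proj₁ e ≟ v ⌋ then 1 else 0)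
                           + (if ⌊ proj₂ e ≟ v ⌋ then 1 else 0)) A)

-- v ∈ V : v is an endpoint of some edge of the stream
Occurs : ∀ {n} → Fin n → List (Edge n) → Set
Occurs v A = Any (λ e → (proj₁ e ≡ v) ⊎ (proj₂ e ≡ v)) A

nodeId : ∀ {n L} → NodeEntry n L → Fin n
nodeId (v , _ , _) = v

nodeLabel : ∀ {n L} → NodeEntry n L → Fin n × Fin L
nodeLabel (v , l , _) = (v , l)

plainEdge : ∀ {n L} → AugEdge n L → Edge n
plainEdge (u , v , _ , _) = (u , v)

ValidLabelAug : ∀ {n L} → List (Edge n) → List (Tok n L) → Set
ValidLabelAug {n} {L} A h =
  Σ (List (NodeEntry n L)) λ hdr → Σ (List (AugEdge n L)) λ E' →
    (h ≡ map nodeTok hdr ++ map edgeTok E')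
    × Linked _<_ (map nodeId hdr)
    × (∀ v → (v ∈ map nodeId hdr → Occurs v A) × (Occurs v A → v ∈ map nodeId hdr))
    × All (λ x → proj₂ (proj₂ x) ≡ degree A (nodeId x)) hdr
    -- l(e,u) = l(u), l(e,v) = l(v)
    × All (λ e → ((proj₁ e , proj₁ (proj₂ (proj₂ e))) ∈ map nodeLabel hdr)
               × ((proj₁ (proj₂ e) , proj₂ (proj₂ (proj₂ e))) ∈ map nodeLabel hdr)) E'
    × (map plainEdge E' ↭ A)

-- word range: a word must hold node ids, labels and counts up to m
wordRange : ℕ → ℕ → ℕ → ℕ
wordRange n m L = 2 + n + m + L

-- An annotation h is valid for the stream A iff (i) h is a strictly increasing header of
-- nodes with positive degree followed by annotated edges, and (ii) two multisets of items
-- agree: the claimed items (the stream edges, and deg(v) copies of (v , l(v)) for each header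
-- entry) and the witnessed items (the annotated edges, and the endpoint labels (u , l(e,u)),
-- (v , l(e,v)) of each of them) -- see valid⇒balanced / balanced⇒valid.  Condition (i) is
-- checked by a finite automaton; condition (ii) by comparing the random linear fingerprints
-- Σ x[item] with x ∈ {0,1,2}^N: different multisets have different multiplicity vectors, and
-- two different linear forms agree on at most a third of all x (collisions, a Schwartz–Zippel
-- bound proved by induction on N).  The memory holds the automaton mode and two counters
-- saturating just above 6m, the largest honest fingerprint, so it has O(1) words.

module Submission where

open import Defs
open import Data.Nat
  using (ℕ; zero; suc; _+_; _*_; _^_; _∸_; _⊓_; _≤_; _<_; z≤n; s≤s; _≤?_; >-nonZero; >-nonZero⁻¹)
open import Data.Nat.Properties
open import Data.Nat.ListAction using (sum)
open import Data.Nat.ListAction.Properties using (sum-↭; sum-++)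
open import Data.Nat.Tactic.RingSolver using (solve-∀)
open import Data.Bool using (if_then_else_)
open import Data.Fin
  using (Fin; zero; suc; toℕ; fromℕ<; _↑ˡ_; _↑ʳ_; combine; remQuot; splitAt) renaming (_<_ to _<ᶠ_)
import Data.Fin.Properties as Fin
open import Data.Maybe using (Maybe; just; nothing)
open import Data.Vec using (Vec; []; _∷_; lookup)
import Data.Vec as Vec using (replicate)
import Data.Vec.Properties as Vecₚ
open import Data.List using (List; []; _∷_; _++_; map; foldl; concatMap; mapMaybe; replicate; length; tabulate)
import Data.List.Properties as List
open import Data.List.Membership.Propositional using (_∈_)
open import Data.List.Membership.Propositional.Properties using (∈-∃++; ∈-map⁺; ∈-map⁻; ∈-++⁻)
import Data.List.Membership.DecPropositional as DecMembership
open import Data.List.Relation.Unary.All using (All; []; _∷_)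
import Data.List.Relation.Unary.All as All
open import Data.List.Relation.Unary.Any using (here; there)
open import Data.List.Relation.Unary.AllPairs using (AllPairs; []; _∷_)
open import Data.List.Relation.Unary.Linked using (Linked; []; [-]; _∷_)
open import Data.List.Relation.Unary.Linked.Properties using (Linked⇒AllPairs)
open import Data.List.Relation.Binary.Permutation.Propositional
  using (_↭_; ↭-refl; ↭-sym; ↭-trans; ↭-prep; ↭-reflexive; module PermutationReasoning)
import Data.List.Relation.Binary.Permutation.Propositional.Properties as Perm
open import Data.Product using (Σ; _×_; _,_; proj₁; proj₂) renaming (map to ×-map)
import Data.Product.Properties as Product
open import Data.Sum using (_⊎_; inj₁; inj₂; [_,_]′)
open import Data.Unit using (⊤; tt)
open import Data.Empty using (⊥; ⊥-elim)
open import Relation.Nullary using (Dec; yes; no; ¬_; _×-dec_)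
open import Relation.Nullary.Decidable using (⌊_⌋)
open import Relation.Binary.Definitions using (DecidableEquality; tri<; tri≈; tri>)
open import Relation.Binary.PropositionalEquality
open import Function using (_∘_; id)
open import Algebra.Properties.CommutativeSemigroup +-commutativeSemigroup using (interchange; x∙yz≈y∙xz)

𝟙[_] : ∀ {p} {P : Set p} → Dec P → ℕ
𝟙[ d ] = if ⌊ d ⌋ then 1 else 0

𝟙-yes : ∀ {p} {P : Set p} (d : Dec P) → P → 𝟙[ d ] ≡ 1
𝟙-yes (yes _) _ = refl
𝟙-yes (no ¬p) p = ⊥-elim (¬p p)

𝟙-no : ∀ {p} {P : Set p} (d : Dec P) → ¬ P → 𝟙[ d ] ≡ 0
𝟙-no (yes p) ¬p = ⊥-elim (¬p p)
𝟙-no (no _) _ = refl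

𝟙-mono : ∀ {p q} {P : Set p} {Q : Set q} (d : Dec P) (e : Dec Q) → (P → Q) → 𝟙[ d ] ≤ 𝟙[ e ]
𝟙-mono (no _) e _ = z≤n
𝟙-mono (yes p) e f = ≤-reflexive (sym (𝟙-yes e (f p)))

𝟙-cong : ∀ {p q} {P : Set p} {Q : Set q} (d : Dec P) (e : Dec Q) → (P → Q) → (Q → P) → 𝟙[ d ] ≡ 𝟙[ e ]
𝟙-cong d e f g = ≤-antisym (𝟙-mono d e f) (𝟙-mono e d g)

∑ : ∀ {k} → (Fin k → ℕ) → ℕ
∑ f = sum (tabulate f)

∑-cong : ∀ {k} {f g : Fin k → ℕ} → (∀ i → f i ≡ g i) → ∑ f ≡ ∑ g
∑-cong p = cong sum (List.tabulate-cong p)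

∑-mono : ∀ {k} {f g : Fin k → ℕ} → (∀ i → f i ≤ g i) → ∑ f ≤ ∑ g
∑-mono {zero} p = z≤n
∑-mono {suc k} p = +-mono-≤ (p zero) (∑-mono (p ∘ suc))

∑-const : ∀ k c → ∑ {k} (λ _ → c) ≡ k * c
∑-const zero c = refl
∑-const (suc k) c = cong (c +_) (∑-const k c)

∑-+ : ∀ {k} (f g : Fin k → ℕ) → ∑ (λ i → f i + g i) ≡ ∑ f + ∑ g
∑-+ {zero} f g = refl
∑-+ {suc k} f g = trans (cong (f zero + g zero +_) (∑-+ (f ∘ suc) (g ∘ suc)))
                        (interchange (f zero) (g zero) _ _)

∑-*ˡ : ∀ {k} c (f : Fin k → ℕ) → c * ∑ f ≡ ∑ (λ i → c * f i)
∑-*ˡ {zero} c f = *-zeroʳ c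
∑-*ˡ {suc k} c f = trans (*-distribˡ-+ c (f zero) _) (cong (c * f zero +_) (∑-*ˡ c (f ∘ suc)))

∑-comm : ∀ {a k} (f : Fin a → Fin k → ℕ) → ∑ (λ t → ∑ (f t)) ≡ ∑ (λ j → ∑ (λ t → f t j))
∑-comm {zero} {k} f = sym (trans (∑-cong {k} (λ _ → refl)) (trans (∑-const k 0) (*-zeroʳ k)))
∑-comm {suc a} f = trans (cong (∑ (f zero) +_) (∑-comm (f ∘ suc)))
                         (sym (∑-+ (f zero) (λ j → ∑ (λ t → f (suc t) j))))

∑-↑ : ∀ a {b} (f : Fin (a + b) → ℕ) → ∑ f ≡ ∑ (λ i → f (i ↑ˡ b)) + ∑ (λ j → f (a ↑ʳ j))
∑-↑ zero f = refl
∑-↑ (suc a) f = trans (cong (f zero +_) (∑-↑ a (f ∘ suc))) (sym (+-assoc (f zero) _ _))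

∑-combine : ∀ a {k} (f : Fin (a * k) → ℕ) → ∑ f ≡ ∑ {a} (λ t → ∑ {k} (λ j → f (combine t j)))
∑-combine zero f = refl
∑-combine (suc a) {k} f =
  trans (∑-↑ k f) (cong (∑ (λ j → f (j ↑ˡ (a * k))) +_) (∑-combine a (λ i → f (k ↑ʳ i))))

∑-atMostOne : ∀ {k} {P : Fin k → Set} (P? : ∀ i → Dec (P i)) →
              (∀ i j → P i → P j → i ≡ j) → ∑ (λ i → 𝟙[ P? i ]) ≤ 1
∑-atMostOne {zero} P? unique = z≤n
∑-atMostOne {suc k} P? unique with P? zero
... | no _ = ∑-atMostOne (P? ∘ suc) (λ i j p q → Fin.suc-injective (unique (suc i) (suc j) p q))
... | yes p = ≤-reflexive (cong suc (trans (∑-cong others) (trans (∑-const k 0) (*-zeroʳ k))))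
  where
    others : ∀ i → 𝟙[ P? (suc i) ] ≡ 0
    others i = 𝟙-no (P? (suc i)) (λ q → Fin.0≢1+n (unique zero (suc i) p q))

randVec : ∀ q N → Fin (q ^ N) → Vec (Fin q) N
randVec q zero _ = []
randVec q (suc N) r = proj₁ (remQuot {q} (q ^ N) r) ∷ randVec q N (proj₂ (remQuot {q} (q ^ N) r))

∑-randVec : ∀ q N (g : Vec (Fin q) (suc N) → ℕ) →
            ∑ (g ∘ randVec q (suc N)) ≡ ∑ {q} (λ t → ∑ (λ j → g (t ∷ randVec q N j)))
∑-randVec q N g = trans (∑-combine q _) (∑-cong λ t → ∑-cong λ j →
  cong (λ z → g (proj₁ z ∷ randVec q N (proj₂ z))) (Fin.remQuot-combine t j))

dot : ∀ {q N} → Vec ℕ N → Vec (Fin q) N → ℕ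
dot [] [] = 0
dot (a ∷ as) (t ∷ ts) = toℕ t * a + dot as ts

affine-unique : ∀ c₀ c₁ a b {t t'} → t < t' →
                c₀ + t * a ≡ c₁ + t * b → c₀ + t' * a ≡ c₁ + t' * b → a ≡ b
affine-unique c₀ c₁ a b {t} {t'} t<t' at-t at-t' =
  *-cancelˡ-≡ a b s {{>-nonZero (m<n⇒0<n∸m t<t')}} (+-cancelˡ-≡ (c₁ + t * b) _ _ shifted)
  where
    open ≡-Reasoning
    s : ℕ
    s = t' ∸ t
    t+s : t + s ≡ t'
    t+s = m+[n∸m]≡n (<⇒≤ t<t')
    split : ∀ c u → c + t' * u ≡ (c + t * u) + s * u
    split c u = trans (cong (λ z → c + z * u) (sym t+s))
                      (trans (cong (c +_) (*-distribʳ-+ u t s)) (sym (+-assoc c _ _)))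
    shifted : (c₁ + t * b) + s * a ≡ (c₁ + t * b) + s * b
    shifted = begin
      (c₁ + t * b) + s * a ≡⟨ cong (_+ s * a) (sym at-t) ⟩
      (c₀ + t * a) + s * a ≡⟨ sym (split c₀ a) ⟩
      c₀ + t' * a          ≡⟨ at-t' ⟩
      c₁ + t' * b          ≡⟨ split c₁ b ⟩
      (c₁ + t * b) + s * b ∎

collisions : ∀ q N (a b : Vec ℕ N) c₀ c₁ → a ≢ b →
  q * ∑ (λ r → 𝟙[ c₀ + dot a (randVec q N r) ≟ c₁ + dot b (randVec q N r) ]) ≤ q ^ N
collisions q zero [] [] c₀ c₁ a≢b = ⊥-elim (a≢b refl)
collisions q (suc N) (a ∷ as) (b ∷ bs) c₀ c₁ a≢b with Vecₚ.≡-dec _≟_ as bs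
... | no as≢bs = begin
    q * ∑ (F ∘ randVec q (suc N))                   ≡⟨ cong (q *_) (∑-randVec q N F) ⟩
    q * ∑ (λ t → ∑ (λ j → F (t ∷ randVec q N j)))   ≡⟨ ∑-*ˡ q (λ t → ∑ (λ j → F (t ∷ randVec q N j))) ⟩
    ∑ (λ t → q * ∑ (λ j → F (t ∷ randVec q N j)))   ≤⟨ ∑-mono slice ⟩
    ∑ {q} (λ _ → q ^ N)                             ≡⟨ ∑-const q (q ^ N) ⟩
    q * q ^ N                                       ∎
  where
    open ≤-Reasoning
    F : Vec (Fin q) (suc N) → ℕ
    F x = 𝟙[ c₀ + dot (a ∷ as) x ≟ c₁ + dot (b ∷ bs) x ]
    -- fixing the first coordinate t leaves a collision problem for the tails
    slice : ∀ t → q * ∑ (λ j → F (t ∷ randVec q N j)) ≤ q ^ N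
    slice t = subst (λ z → q * z ≤ q ^ N)
      (∑-cong λ j → let x = randVec q N j in
        cong₂ (λ u v → 𝟙[ u ≟ v ]) (+-assoc c₀ (toℕ t * a) (dot as x)) (+-assoc c₁ (toℕ t * b) (dot bs x)))
      (collisions q N as bs (c₀ + toℕ t * a) (c₁ + toℕ t * b) as≢bs)
... | yes refl = begin
    q * ∑ (F ∘ randVec q (suc N))                    ≡⟨ cong (q *_) (∑-randVec q N F) ⟩
    q * ∑ (λ t → ∑ (λ j → F (t ∷ randVec q N j)))    ≡⟨ cong (q *_) (∑-comm (λ t j → F (t ∷ randVec q N j))) ⟩
    q * ∑ (λ j → ∑ (λ t → F (t ∷ randVec q N j)))    ≤⟨ *-monoʳ-≤ q (∑-mono at-most-one-head) ⟩
    q * ∑ {q ^ N} (λ _ → 1)                          ≡⟨ cong (q *_) (trans (∑-const (q ^ N) 1) (*-identityʳ _)) ⟩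
    q * q ^ N                                        ∎
  where
    open ≤-Reasoning
    F : Vec (Fin q) (suc N) → ℕ
    F x = 𝟙[ c₀ + dot (a ∷ as) x ≟ c₁ + dot (b ∷ as) x ]
    a≢b′ : a ≢ b
    a≢b′ refl = a≢b refl
    solves : ∀ d t → c₀ + (toℕ t * a + d) ≡ c₁ + (toℕ t * b + d) → c₀ + toℕ t * a ≡ c₁ + toℕ t * b
    solves d t e = +-cancelʳ-≡ d _ _ (trans (+-assoc c₀ _ d) (trans e (sym (+-assoc c₁ _ d))))
    unique : ∀ d (t t' : Fin q) → c₀ + (toℕ t * a + d) ≡ c₁ + (toℕ t * b + d) →
             c₀ + (toℕ t' * a + d) ≡ c₁ + (toℕ t' * b + d) → t ≡ t'
    unique d t t' e e' with Fin.<-cmp t t'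
    ... | tri< t<t' _ _ = ⊥-elim (a≢b′ (affine-unique c₀ c₁ a b t<t' (solves d t e) (solves d t' e')))
    ... | tri≈ _ t≡t' _ = t≡t'
    ... | tri> _ _ t'<t = ⊥-elim (a≢b′ (affine-unique c₀ c₁ a b t'<t (solves d t' e') (solves d t e)))
    at-most-one-head : ∀ j → ∑ (λ t → F (t ∷ randVec q N j)) ≤ 1
    at-most-one-head j = ∑-atMostOne _ (unique (dot as (randVec q N j)))

module Multiplicity {A : Set} (_≟ᴬ_ : DecidableEquality A) where

  occ : A → List A → ℕ
  occ a xs = sum (map (λ x → 𝟙[ x ≟ᴬ a ]) xs)

  occ-↭ : ∀ a {xs ys} → xs ↭ ys → occ a xs ≡ occ a ys
  occ-↭ a p = sum-↭ (Perm.map⁺ _ p)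

  occ-∈ : ∀ a xs → 1 ≤ occ a xs → a ∈ xs
  occ-∈ a (x ∷ xs) p with x ≟ᴬ a
  ... | yes refl = here refl
  ... | no _ = there (occ-∈ a xs p)

  occ-head : ∀ a xs → occ a (a ∷ xs) ≡ suc (occ a xs)
  occ-head a xs = cong (_+ occ a xs) (𝟙-yes (a ≟ᴬ a) refl)

  occ⇒↭ : ∀ xs ys → (∀ a → occ a xs ≡ occ a ys) → xs ↭ ys
  occ⇒↭ [] [] same = ↭-refl
  occ⇒↭ [] (y ∷ ys) same with trans (same y) (occ-head y ys)
  ... | ()
  occ⇒↭ (x ∷ xs) ys same
    with ws , zs , refl ← ∈-∃++ (occ-∈ x ys (subst (1 ≤_) (trans (sym (occ-head x xs)) (same x)) (s≤s z≤n)))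
    = ↭-trans (↭-prep x (occ⇒↭ xs (ws ++ zs) rest)) (↭-sym (Perm.shift x ws zs))
    where
      rest : ∀ a → occ a xs ≡ occ a (ws ++ zs)
      rest a = +-cancelˡ-≡ 𝟙[ x ≟ᴬ a ] _ _ (trans (same a) (occ-↭ a (Perm.shift x ws zs)))

open Multiplicity using (occ; occ-↭; occ⇒↭)

bump : ∀ {N} → Fin N → Vec ℕ N → Vec ℕ N
bump zero (c ∷ cs) = suc c ∷ cs
bump (suc k) (c ∷ cs) = c ∷ bump k cs

countVec : ∀ {N} → List (Fin N) → Vec ℕ N
countVec [] = Vec.replicate _ 0
countVec (k ∷ ks) = bump k (countVec ks)

lookup-bump : ∀ {N} (k i : Fin N) cs → lookup (bump k cs) i ≡ 𝟙[ k Fin.≟ i ] + lookup cs i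
lookup-bump zero zero (c ∷ cs) = refl
lookup-bump zero (suc i) (c ∷ cs) = refl
lookup-bump (suc k) zero (c ∷ cs) = refl
lookup-bump (suc k) (suc i) (c ∷ cs) with k Fin.≟ i | lookup-bump k i cs
... | yes _ | r = r
... | no _ | r = r

lookup-countVec : ∀ {N} (ks : List (Fin N)) i → lookup (countVec ks) i ≡ occ Fin._≟_ i ks
lookup-countVec [] i = Vecₚ.lookup-replicate i 0
lookup-countVec (k ∷ ks) i = trans (lookup-bump k i (countVec ks)) (cong (𝟙[ k Fin.≟ i ] +_) (lookup-countVec ks i))

countVec-↭ : ∀ {N} (ks ks' : List (Fin N)) → countVec ks ≡ countVec ks' → ks ↭ ks'
countVec-↭ ks ks' e = occ⇒↭ Fin._≟_ ks ks' λ i →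
  trans (sym (lookup-countVec ks i)) (trans (cong (λ v → lookup v i) e) (lookup-countVec ks' i))

fp : ∀ {q N} → Vec (Fin q) N → List (Fin N) → ℕ
fp x ks = sum (map (λ k → toℕ (lookup x k)) ks)

dot-bump : ∀ {q N} (k : Fin N) cs (x : Vec (Fin q) N) → dot (bump k cs) x ≡ toℕ (lookup x k) + dot cs x
dot-bump zero (c ∷ cs) (t ∷ ts) = trans (cong (_+ dot cs ts) (*-suc (toℕ t) c)) (+-assoc (toℕ t) _ _)
dot-bump (suc k) (c ∷ cs) (t ∷ ts) = trans (cong (toℕ t * c +_) (dot-bump k cs ts))
                                             (x∙yz≈y∙xz (toℕ t * c) (toℕ (lookup ts k)) _)

dot-zero : ∀ {q N} (x : Vec (Fin q) N) → dot (Vec.replicate N 0) x ≡ 0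
dot-zero [] = refl
dot-zero (t ∷ ts) = trans (cong (_+ dot (Vec.replicate _ 0) ts) (*-zeroʳ (toℕ t))) (dot-zero ts)

fp≡dot : ∀ {q N} (x : Vec (Fin q) N) ks → fp x ks ≡ dot (countVec ks) x
fp≡dot x [] = sym (dot-zero x)
fp≡dot x (k ∷ ks) = trans (cong (toℕ (lookup x k) +_) (fp≡dot x ks)) (sym (dot-bump k (countVec ks) x))

fp-collisions : ∀ q N (ks ks' : List (Fin N)) → ¬ (ks ↭ ks') →
  q * ∑ (λ r → 𝟙[ fp (randVec q N r) ks ≟ fp (randVec q N r) ks' ]) ≤ q ^ N
fp-collisions q N ks ks' ks≁ks' = subst (λ z → q * z ≤ q ^ N)
  (∑-cong λ r → let x = randVec q N r in cong₂ (λ u v → 𝟙[ u ≟ v ]) (sym (fp≡dot x ks)) (sym (fp≡dot x ks')))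
  (collisions q N (countVec ks) (countVec ks') 0 0 (ks≁ks' ∘ countVec-↭ ks ks'))

module _ {A B : Set} where

  leftOf : A ⊎ B → Maybe A
  leftOf (inj₁ a) = just a
  leftOf (inj₂ _) = nothing

  rightOf : A ⊎ B → Maybe B
  rightOf (inj₁ _) = nothing
  rightOf (inj₂ b) = just b

  lefts-inj : ∀ (xs : List A) (ys : List B) → mapMaybe leftOf (map inj₁ xs ++ map inj₂ ys) ≡ xs
  lefts-inj (x ∷ xs) ys = cong (x ∷_) (lefts-inj xs ys)
  lefts-inj [] [] = refl
  lefts-inj [] (y ∷ ys) = lefts-inj [] ys

  rights-inj : ∀ (xs : List A) (ys : List B) → mapMaybe rightOf (map inj₁ xs ++ map inj₂ ys) ≡ ys
  rights-inj (x ∷ xs) ys = rights-inj xs ys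
  rights-inj [] [] = refl
  rights-inj [] (y ∷ ys) = cong (y ∷_) (rights-inj [] ys)

  ⊎-↭⁻ : ∀ {xs xs' : List A} {ys ys' : List B} →
         map inj₁ xs ++ map inj₂ ys ↭ map inj₁ xs' ++ map inj₂ ys' → (xs ↭ xs') × (ys ↭ ys')
  ⊎-↭⁻ {xs} {xs'} {ys} {ys'} p =
    subst₂ _↭_ (lefts-inj xs ys) (lefts-inj xs' ys') (Perm.mapMaybe-↭ leftOf p) ,
    subst₂ _↭_ (rights-inj xs ys) (rights-inj xs' ys') (Perm.mapMaybe-↭ rightOf p)

  ⊎-↭⁺ : ∀ {xs xs' : List A} {ys ys' : List B} → xs ↭ xs' → ys ↭ ys' →
         map inj₁ xs ++ map inj₂ ys ↭ map inj₁ xs' ++ map inj₂ ys'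
  ⊎-↭⁺ p q = Perm.++⁺ (Perm.map⁺ inj₁ p) (Perm.map⁺ inj₂ q)

  separate : ∀ {T : Set} (f : T → List A) (g : T → List B) ts →
             concatMap (λ t → map inj₁ (f t) ++ map inj₂ (g t)) ts ↭
             map inj₁ (concatMap f ts) ++ map inj₂ (concatMap g ts)
  separate f g [] = ↭-refl
  separate f g (t ∷ ts) = begin
    (F ++ G) ++ rest                  ≡⟨ List.++-assoc F G rest ⟩
    F ++ G ++ rest                    ↭⟨ Perm.++⁺ˡ F (Perm.++⁺ˡ G (separate f g ts)) ⟩
    F ++ G ++ Fs ++ Gs                ↭⟨ Perm.++⁺ˡ F (Perm.shifts G Fs) ⟩
    F ++ Fs ++ G ++ Gs                ≡⟨ sym (List.++-assoc F Fs (G ++ Gs)) ⟩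
    (F ++ Fs) ++ G ++ Gs              ≡⟨ sym (cong₂ _++_ (List.map-++ inj₁ (f t) _) (List.map-++ inj₂ (g t) _)) ⟩
    map inj₁ (f t ++ concatMap f ts) ++ map inj₂ (g t ++ concatMap g ts) ∎
    where
      open PermutationReasoning
      F = map inj₁ (f t)
      G = map inj₂ (g t)
      Fs = map inj₁ (concatMap f ts)
      Gs = map inj₂ (concatMap g ts)
      rest = concatMap (λ t → map inj₁ (f t) ++ map inj₂ (g t)) ts

Label : ℕ → ℕ → Set
Label n L = Fin n × Fin L

Item : ℕ → ℕ → Set
Item n L = Edge n ⊎ Label n L

module _ {n L : ℕ} where

  tokEdges : Tok n L → List (Edge n)
  tokEdges (nodeT _ _ _) = []
  tokEdges (edgeT u v _ _) = (u , v) ∷ []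

  tokClaims : Tok n L → List (Label n L)
  tokClaims (nodeT v l d) = replicate d (v , l)
  tokClaims (edgeT _ _ _ _) = []

  tokUses : Tok n L → List (Label n L)
  tokUses (nodeT _ _ _) = []
  tokUses (edgeT u v lu lv) = (u , lu) ∷ (v , lv) ∷ []

  posTok negTok : Tok n L → List (Item n L)
  posTok t = map inj₂ (tokClaims t)
  negTok t = map inj₁ (tokEdges t) ++ map inj₂ (tokUses t)

  claimed : List (Edge n) → List (Tok n L) → List (Item n L)
  claimed A h = map inj₁ A ++ concatMap posTok h

  witnessed : List (Tok n L) → List (Item n L)
  witnessed h = concatMap negTok h

  claimed-parts : ∀ A h → claimed A h ≡ map inj₁ A ++ map inj₂ (concatMap tokClaims h)
  claimed-parts A h = cong (map inj₁ A ++_) (sym (List.map-concatMap inj₂ tokClaims h))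

  balanced⁻ : ∀ A h → claimed A h ↭ witnessed h →
              (A ↭ concatMap tokEdges h) × (concatMap tokClaims h ↭ concatMap tokUses h)
  balanced⁻ A h p =
    ⊎-↭⁻ (↭-trans (↭-reflexive (sym (claimed-parts A h))) (↭-trans p (separate tokEdges tokUses h)))

  balanced⁺ : ∀ A h → A ↭ concatMap tokEdges h → concatMap tokClaims h ↭ concatMap tokUses h →
              claimed A h ↭ witnessed h
  balanced⁺ A h p q =
    ↭-trans (↭-reflexive (claimed-parts A h)) (↭-trans (⊎-↭⁺ p q) (↭-sym (separate tokEdges tokUses h)))

module _ {n L : ℕ} where

  annotation : List (NodeEntry n L) → List (AugEdge n L) → List (Tok n L)
  annotation hdr E' = map nodeTok hdr ++ map edgeTok E'

  nodeDeg : NodeEntry n L → ℕ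
  nodeDeg (_ , _ , d) = d

  claims : List (NodeEntry n L) → List (Label n L)
  claims = concatMap (λ x → replicate (nodeDeg x) (nodeLabel x))

  uses : List (AugEdge n L) → List (Label n L)
  uses = concatMap (λ { (u , v , lu , lv) → (u , lu) ∷ (v , lv) ∷ [] })

  edges-annotation : ∀ hdr E' → concatMap tokEdges (annotation hdr E') ≡ map plainEdge E'
  edges-annotation (x ∷ hdr) E' = edges-annotation hdr E'
  edges-annotation [] [] = refl
  edges-annotation [] (e ∷ E') = cong (plainEdge e ∷_) (edges-annotation [] E')

  claims-annotation : ∀ hdr E' → concatMap tokClaims (annotation hdr E') ≡ claims hdr
  claims-annotation (x ∷ hdr) E' = cong (replicate (nodeDeg x) (nodeLabel x) ++_) (claims-annotation hdr E')
  claims-annotation [] [] = refl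
  claims-annotation [] (e ∷ E') = claims-annotation [] E'

  uses-annotation : ∀ hdr E' → concatMap tokUses (annotation hdr E') ≡ uses E'
  uses-annotation (x ∷ hdr) E' = uses-annotation hdr E'
  uses-annotation [] [] = refl
  uses-annotation [] (e ∷ E') = cong (λ z → _ ∷ _ ∷ z) (uses-annotation [] E')

∈-replicate : ∀ {X : Set} {x y : X} d → y ∈ replicate d x → y ≡ x
∈-replicate (suc d) (here refl) = refl
∈-replicate (suc d) (there p) = ∈-replicate d p

module _ {n : ℕ} where

  mult : ∀ {X : Set} → Fin n → List (Fin n × X) → ℕ
  mult v ys = occ Fin._≟_ v (map proj₁ ys)

  mult-↭ : ∀ {X : Set} v {ys ys' : List (Fin n × X)} → ys ↭ ys' → mult v ys ≡ mult v ys'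
  mult-↭ v p = occ-↭ Fin._≟_ v (Perm.map⁺ proj₁ p)

  mult-++ : ∀ {X : Set} v (xs ys : List (Fin n × X)) → mult v (xs ++ ys) ≡ mult v xs + mult v ys
  mult-++ v [] ys = refl
  mult-++ v (x ∷ xs) ys =
    trans (cong (𝟙[ proj₁ x Fin.≟ v ] +_) (mult-++ v xs ys)) (sym (+-assoc 𝟙[ proj₁ x Fin.≟ v ] (mult v xs) (mult v ys)))

  mult-replicate : ∀ {X : Set} v d (w : Fin n) (l : X) → mult v (replicate d (w , l)) ≡ d * 𝟙[ w Fin.≟ v ]
  mult-replicate v zero w l = refl
  mult-replicate v (suc d) w l = cong (𝟙[ w Fin.≟ v ] +_) (mult-replicate v d w l)

  degree-↭ : ∀ v {A B : List (Edge n)} → A ↭ B → degree A v ≡ degree B v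
  degree-↭ v p = sum-↭ (Perm.map⁺ _ p)

  degree⇒occurs : ∀ v (A : List (Edge n)) → 1 ≤ degree A v → Occurs v A
  degree⇒occurs v ((a , b) ∷ A) p with a Fin.≟ v | b Fin.≟ v
  ... | yes a≡v | _ = here (inj₁ a≡v)
  ... | no _ | yes b≡v = here (inj₂ b≡v)
  ... | no _ | no _ = there (degree⇒occurs v A p)

  occurs⇒degree : ∀ v (A : List (Edge n)) → Occurs v A → 1 ≤ degree A v
  occurs⇒degree v ((a , b) ∷ A) (here (inj₁ refl)) =
    ≤-trans (≤-reflexive (sym (𝟙-yes (a Fin.≟ a) refl)))
            (≤-trans (m≤m+n _ 𝟙[ b Fin.≟ a ]) (m≤m+n _ (degree A a)))
  occurs⇒degree v ((a , b) ∷ A) (here (inj₂ refl)) =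
    ≤-trans (≤-reflexive (sym (𝟙-yes (b Fin.≟ b) refl)))
            (≤-trans (m≤n+m _ 𝟙[ a Fin.≟ b ]) (m≤m+n _ (degree A b)))
  occurs⇒degree v ((a , b) ∷ A) (there p) =
    ≤-trans (occurs⇒degree v A p) (m≤n+m _ (𝟙[ a Fin.≟ v ] + 𝟙[ b Fin.≟ v ]))

module _ {n L : ℕ} where

  ids : List (NodeEntry n L) → List (Fin n)
  ids = map nodeId

  labels : List (NodeEntry n L) → List (Label n L)
  labels = map nodeLabel

  degree-uses : ∀ v (E' : List (AugEdge n L)) → degree (map plainEdge E') v ≡ mult v (uses E')
  degree-uses v [] = refl
  degree-uses v ((a , b , _ , _) ∷ E') =
    trans (+-assoc 𝟙[ a Fin.≟ v ] 𝟙[ b Fin.≟ v ] _)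
          (cong (λ z → 𝟙[ a Fin.≟ v ] + (𝟙[ b Fin.≟ v ] + z)) (degree-uses v E'))

  fresh : ∀ {w : Fin n} (hdr : List (NodeEntry n L)) → All (w <ᶠ_) (ids hdr) → ¬ (w ∈ ids hdr)
  fresh hdr w<hdr w∈ = Fin.<-irrefl refl (All.lookup w<hdr w∈)

  label-id : ∀ {v l} (hdr : List (NodeEntry n L)) → (v , l) ∈ labels hdr → v ∈ ids hdr
  label-id (x ∷ hdr) (here refl) = here refl
  label-id (x ∷ hdr) (there p) = there (label-id hdr p)

  claims⊆labels : ∀ (hdr : List (NodeEntry n L)) {y} → y ∈ claims hdr → y ∈ labels hdr
  claims⊆labels (x ∷ hdr) p with ∈-++⁻ (replicate (nodeDeg x) (nodeLabel x)) p
  ... | inj₁ q = here (∈-replicate (nodeDeg x) q)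
  ... | inj₂ q = there (claims⊆labels hdr q)

  mult-entry-≡ : ∀ (v : Fin n) d (l : Fin L) → mult v (replicate d (v , l)) ≡ d
  mult-entry-≡ v d l =
    trans (mult-replicate v d v l) (trans (cong (d *_) (𝟙-yes (v Fin.≟ v) refl)) (*-identityʳ d))

  mult-entry-≢ : ∀ {v w : Fin n} d (l : Fin L) → w ≢ v → mult v (replicate d (w , l)) ≡ 0
  mult-entry-≢ {v} {w} d l w≢v =
    trans (mult-replicate v d w l) (trans (cong (d *_) (𝟙-no (w Fin.≟ v) w≢v)) (*-zeroʳ d))

  claimed-node : ∀ v (hdr : List (NodeEntry n L)) → 1 ≤ mult v (claims hdr) → v ∈ ids hdr
  claimed-node v ((w , l , d) ∷ hdr) p with w Fin.≟ v
  ... | yes w≡v = here (sym w≡v)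
  ... | no w≢v = there (claimed-node v hdr (subst (1 ≤_) rest p))
    where
      rest : mult v (claims ((w , l , d) ∷ hdr)) ≡ mult v (claims hdr)
      rest = trans (mult-++ v (replicate d (w , l)) (claims hdr)) (cong (_+ mult v (claims hdr)) (mult-entry-≢ d l w≢v))

  claims-entry : ∀ (hdr : List (NodeEntry n L)) → AllPairs _<ᶠ_ (ids hdr) →
                 ∀ {x} → x ∈ hdr → mult (nodeId x) (claims hdr) ≡ nodeDeg x
  claims-entry ((v , l , d) ∷ hdr) (v<hdr ∷ _) (here refl) =
    trans (mult-++ v (replicate d (v , l)) (claims hdr))
          (trans (cong₂ _+_ (mult-entry-≡ v d l) (n<1⇒n≡0 (≰⇒> (fresh hdr v<hdr ∘ claimed-node v hdr))))
                 (+-identityʳ d))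
  claims-entry ((w , l , d) ∷ hdr) (w<hdr ∷ sorted) {x} (there x∈) =
    trans (mult-++ (nodeId x) (replicate d (w , l)) (claims hdr))
          (cong₂ _+_ (mult-entry-≢ d l (Fin.<⇒≢ (All.lookup w<hdr (∈-map⁺ nodeId x∈))))
                     (claims-entry hdr sorted x∈))

  labels-functional : ∀ (hdr : List (NodeEntry n L)) → AllPairs _<ᶠ_ (ids hdr) →
                      ∀ {v l l'} → (v , l) ∈ labels hdr → (v , l') ∈ labels hdr → l ≡ l'
  labels-functional (x ∷ hdr) _ (here refl) (here refl) = refl
  labels-functional (x ∷ hdr) (x<hdr ∷ _) (here refl) (there q) = ⊥-elim (fresh hdr x<hdr (label-id hdr q))
  labels-functional (x ∷ hdr) (x<hdr ∷ _) (there p) (here refl) = ⊥-elim (fresh hdr x<hdr (label-id hdr p))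
  labels-functional (x ∷ hdr) (_ ∷ sorted) (there p) (there q) = labels-functional hdr sorted p q

  _≟ˡ_ : DecidableEquality (Label n L)
  _≟ˡ_ = Product.≡-dec Fin._≟_ Fin._≟_

  open DecMembership _≟ˡ_ using (_∈?_)

  label-count : ∀ (zs : List (Label n L)) → (∀ {v l l'} → (v , l) ∈ zs → (v , l') ∈ zs → l ≡ l') →
                ∀ v l ys → All (_∈ zs) ys → occ _≟ˡ_ (v , l) ys ≡ mult v ys * 𝟙[ (v , l) ∈? zs ]
  label-count zs functional v l [] [] = refl
  label-count zs functional v l (y ∷ ys) (y∈ ∷ ys⊆) =
    trans (cong₂ _+_ (point y y∈) (label-count zs functional v l ys ys⊆))
          (sym (*-distribʳ-+ 𝟙[ (v , l) ∈? zs ] 𝟙[ proj₁ y Fin.≟ v ] (mult v ys)))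
    where
      point : ∀ y → y ∈ zs → 𝟙[ y ≟ˡ (v , l) ] ≡ 𝟙[ proj₁ y Fin.≟ v ] * 𝟙[ (v , l) ∈? zs ]
      point (a , b) y∈ with (a , b) ≟ˡ (v , l)
      ... | yes refl = sym (cong₂ _*_ (𝟙-yes (a Fin.≟ a) refl) (𝟙-yes ((a , b) ∈? zs) y∈))
      ... | no y≢ with a Fin.≟ v
      ...   | no _ = refl
      ...   | yes refl = sym (cong (1 *_) (𝟙-no ((a , l) ∈? zs) (λ l∈ → y≢ (cong (a ,_) (functional y∈ l∈)))))

  Labelled : List (Label n L) → AugEdge n L → Set
  Labelled zs (u , v , lu , lv) = ((u , lu) ∈ zs) × ((v , lv) ∈ zs)

  uses-endpoints : ∀ (E' : List (AugEdge n L)) {e} → e ∈ E' → Labelled (uses E') e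
  uses-endpoints (e ∷ E') (here refl) = here refl , there (here refl)
  uses-endpoints (e ∷ E') (there p) = ×-map (there ∘ there) (there ∘ there) (uses-endpoints E' p)

  uses-labelled : ∀ (zs : List (Label n L)) (E' : List (AugEdge n L)) → All (Labelled zs) E' → All (_∈ zs) (uses E')
  uses-labelled zs [] [] = []
  uses-labelled zs (e ∷ E') ((u∈ , v∈) ∷ rest) = u∈ ∷ v∈ ∷ uses-labelled zs E' rest

module _ {n L : ℕ} where

  Positive : NodeEntry n L → Set
  Positive x = 1 ≤ nodeDeg x

  WellFormed : List (Tok n L) → Set
  WellFormed h = Σ (List (NodeEntry n L)) λ hdr → Σ (List (AugEdge n L)) λ E' →
    (h ≡ annotation hdr E') × Linked _<ᶠ_ (ids hdr) × All Positive hdr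

  balanced⇒valid : ∀ (A : List (Edge n)) h → WellFormed h → claimed A h ↭ witnessed h → ValidLabelAug A h
  balanced⇒valid A h (hdr , E' , refl , lk , positive) bal =
    hdr , E' , refl , lk , occurs , All.tabulate entry-degree , labelled , ↭-sym A↭E'
    where
      A↭E' : A ↭ map plainEdge E'
      A↭E' = subst (A ↭_) (edges-annotation hdr E') (proj₁ (balanced⁻ A h bal))
      claims↭uses : claims hdr ↭ uses E'
      claims↭uses = subst₂ _↭_ (claims-annotation hdr E') (uses-annotation hdr E') (proj₂ (balanced⁻ A h bal))
      agree : ∀ v → mult v (claims hdr) ≡ degree A v
      agree v = trans (mult-↭ v claims↭uses) (trans (sym (degree-uses v E')) (degree-↭ v (↭-sym A↭E')))
      entry-degree : ∀ {x} → x ∈ hdr → nodeDeg x ≡ degree A (nodeId x)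
      entry-degree {x} x∈ = trans (sym (claims-entry hdr (Linked⇒AllPairs Fin.<-trans lk) x∈)) (agree (nodeId x))
      occurs : ∀ v → (v ∈ ids hdr → Occurs v A) × (Occurs v A → v ∈ ids hdr)
      occurs v = in-stream , λ o → claimed-node v hdr (subst (1 ≤_) (sym (agree v)) (occurs⇒degree v A o))
        where
          in-stream : v ∈ ids hdr → Occurs v A
          in-stream v∈ with x , x∈ , refl ← ∈-map⁻ nodeId v∈ =
            degree⇒occurs v A (subst (1 ≤_) (entry-degree x∈) (All.lookup positive x∈))
      labelled = All.tabulate λ e∈ →
        ×-map (claims⊆labels hdr ∘ Perm.∈-resp-↭ (↭-sym claims↭uses))
                         (claims⊆labels hdr ∘ Perm.∈-resp-↭ (↭-sym claims↭uses)) (uses-endpoints E' e∈)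

  valid⇒balanced : ∀ (A : List (Edge n)) h → ValidLabelAug A h → WellFormed h × (claimed A h ↭ witnessed h)
  valid⇒balanced A h (hdr , E' , refl , lk , occurs , degs , labelled , E'↭A) =
    (hdr , E' , refl , lk , positive) ,
    balanced⁺ A h (subst (A ↭_) (sym (edges-annotation hdr E')) (↭-sym E'↭A))
                  (subst₂ _↭_ (sym (claims-annotation hdr E')) (sym (uses-annotation hdr E')) claims↭uses)
    where
      open DecMembership (Fin._≟_ {n}) using () renaming (_∈?_ to _∈ⁿ?_)
      sorted : AllPairs _<ᶠ_ (ids hdr)
      sorted = Linked⇒AllPairs Fin.<-trans lk
      positive : All Positive hdr
      positive = All.tabulate λ {x} x∈ → subst (1 ≤_) (sym (All.lookup degs x∈))
        (occurs⇒degree (nodeId x) A (proj₁ (occurs (nodeId x)) (∈-map⁺ nodeId x∈)))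
      agree : ∀ v → mult v (claims hdr) ≡ degree A v
      agree v with v ∈ⁿ? ids hdr
      ... | yes v∈ with x , x∈ , refl ← ∈-map⁻ nodeId v∈ =
        trans (claims-entry hdr sorted x∈) (All.lookup degs x∈)
      ... | no v∉ = trans (n<1⇒n≡0 (≰⇒> (v∉ ∘ claimed-node v hdr)))
                          (sym (n<1⇒n≡0 (≰⇒> (v∉ ∘ proj₂ (occurs v) ∘ degree⇒occurs v A))))
      claims↭uses : claims hdr ↭ uses E'
      claims↭uses = occ⇒↭ _≟ˡ_ (claims hdr) (uses E') λ { (v , l) → begin
        occ _≟ˡ_ (v , l) (claims hdr)      ≡⟨ count (claims hdr) (All.tabulate (claims⊆labels hdr)) ⟩
        mult v (claims hdr) * B v l        ≡⟨ cong (_* B v l) (trans (agree v) (degree-↭ v (↭-sym E'↭A))) ⟩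
        degree (map plainEdge E') v * B v l ≡⟨ cong (_* B v l) (degree-uses v E') ⟩
        mult v (uses E') * B v l           ≡⟨ count (uses E') (uses-labelled (labels hdr) E' labelled) ⟨
        occ _≟ˡ_ (v , l) (uses E')         ∎ }
        where
          open ≡-Reasoning
          open DecMembership _≟ˡ_ using (_∈?_)
          B : Fin n → Fin L → ℕ
          B v l = 𝟙[ (v , l) ∈? labels hdr ]
          count : ∀ {v l} ys → All (_∈ labels hdr) ys → occ _≟ˡ_ (v , l) ys ≡ mult v ys * B v l
          count {v} {l} ys = label-count (labels hdr) (labels-functional hdr sorted) v l ys

  length-witnessed : ∀ (hdr : List (NodeEntry n L)) (E' : List (AugEdge n L)) →
                     length (witnessed (annotation hdr E')) ≡ 3 * length E'
  length-witnessed ((v , l , d) ∷ hdr) E' = length-witnessed hdr E'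
  length-witnessed [] [] = refl
  length-witnessed [] (e ∷ E') = trans (cong (3 +_) (length-witnessed [] E')) (sym (*-suc 3 (length E')))

data Mode (n : ℕ) : Set where
  dead : Mode n
  header : Maybe (Fin n) → Mode n    -- reading the header; the last node id read
  edges : Mode n

module _ {n : ℕ} where

  Alive : Mode n → Set
  Alive dead = ⊥
  Alive _ = ⊤

  alive? : ∀ md → Dec (Alive md)
  alive? dead = no λ ()
  alive? (header _) = yes tt
  alive? edges = yes tt

  Above : Maybe (Fin n) → Fin n → Set
  Above nothing v = ⊤
  Above (just u) v = u <ᶠ v

  above? : ∀ last v → Dec (Above last v)
  above? nothing v = yes tt
  above? (just u) v = u Fin.<? v

  After : Maybe (Fin n) → List (Fin n) → Set
  After nothing vs = Linked _<ᶠ_ vs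
  After (just u) vs = Linked _<ᶠ_ (u ∷ vs)

  after-[] : ∀ last → After last []
  after-[] nothing = []
  after-[] (just u) = [-]

  after-∷⁺ : ∀ last {v vs} → Above last v → After (just v) vs → After last (v ∷ vs)
  after-∷⁺ nothing _ sorted = sorted
  after-∷⁺ (just u) u<v sorted = u<v ∷ sorted

  after-∷⁻ : ∀ last {v vs} → After last (v ∷ vs) → Above last v × After (just v) vs
  after-∷⁻ nothing sorted = tt , sorted
  after-∷⁻ (just u) (u<v ∷ sorted) = u<v , sorted

module _ {n L : ℕ} where

  step : Mode n → Tok n L → Mode n
  step dead _ = dead
  step (header last) (nodeT v l d) with above? last v ×-dec (1 ≤? d)
  ... | yes _ = header (just v)
  ... | no _ = dead
  step (header _) (edgeT _ _ _ _) = edges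
  step edges (nodeT _ _ _) = dead
  step edges (edgeT _ _ _ _) = edges

  run-mode : Mode n → List (Tok n L) → Mode n
  run-mode = foldl step

  run-dead : ∀ h → ¬ Alive (run-mode dead h)
  run-dead [] ()
  run-dead (t ∷ h) = run-dead h

  ParsedFrom : Maybe (Fin n) → List (Tok n L) → Set
  ParsedFrom last h = Σ (List (NodeEntry n L)) λ hdr → Σ (List (AugEdge n L)) λ E' →
    (h ≡ annotation hdr E') × After last (ids hdr) × All Positive hdr

  edges-parse : ∀ h → Alive (run-mode edges h) → Σ (List (AugEdge n L)) λ E' → h ≡ map edgeTok E'
  edges-parse [] _ = [] , refl
  edges-parse (nodeT _ _ _ ∷ h) alive = ⊥-elim (run-dead h alive)
  edges-parse (edgeT u v lu lv ∷ h) alive with E' , refl ← edges-parse h alive = (u , v , lu , lv) ∷ E' , refl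

  header-parse : ∀ last h → Alive (run-mode (header last) h) → ParsedFrom last h
  header-parse last [] _ = [] , [] , refl , after-[] last , []
  header-parse last (edgeT u v lu lv ∷ h) alive with E' , refl ← edges-parse h alive =
    [] , (u , v , lu , lv) ∷ E' , refl , after-[] last , []
  header-parse last (nodeT v l d ∷ h) alive with above? last v ×-dec (1 ≤? d)
  ... | no _ = ⊥-elim (run-dead h alive)
  ... | yes (above , positive) with hdr , E' , refl , sorted , positives ← header-parse (just v) h alive =
    (v , l , d) ∷ hdr , E' , refl , after-∷⁺ last above sorted , positive ∷ positives

  edges-run : ∀ (E' : List (AugEdge n L)) → run-mode edges (map edgeTok E') ≡ edges
  edges-run [] = refl
  edges-run (e ∷ E') = edges-run E'

  header-run : ∀ last hdr (E' : List (AugEdge n L)) → After last (ids hdr) → All Positive hdr →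
               Alive (run-mode (header last) (annotation hdr E'))
  header-run last [] [] _ _ = tt
  header-run last [] (e ∷ E') _ _ = subst Alive (sym (edges-run E')) tt
  header-run last ((v , l , d) ∷ hdr) E' sorted (positive ∷ positives) with above? last v ×-dec (1 ≤? d)
  ... | yes _ = header-run (just v) hdr E' (proj₂ (after-∷⁻ last sorted)) positives
  ... | no fails = ⊥-elim (fails (proj₁ (after-∷⁻ last sorted) , positive))

  alive⇒wellFormed : ∀ h → Alive (run-mode (header nothing) h) → WellFormed h
  alive⇒wellFormed = header-parse nothing

  wellFormed⇒alive : ∀ h → WellFormed h → Alive (run-mode (header nothing) h)
  wellFormed⇒alive h (hdr , E' , refl , sorted , positives) = header-run nothing hdr E' sorted positives

-- Running a machine on finite codes simulates the abstract machine, provided each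
-- step only depends on what the code of its input state retains.
simulate : ∀ {St F X : Set} (enc : St → F) (dec : F → St) (step : St → X → St) →
           (∀ σ x → enc (step (dec (enc σ)) x) ≡ enc (step σ x)) →
           ∀ σ xs → foldl (λ s x → enc (step (dec s) x)) (enc σ) xs ≡ enc (foldl step σ xs)
simulate enc dec step faithful σ [] = refl
simulate enc dec step faithful σ (x ∷ xs) =
  trans (cong (λ s → foldl (λ s x → enc (step (dec s) x)) s xs) (faithful σ x))
        (simulate enc dec step faithful (step σ x) xs)

module Protocol (n m L : ℕ) where

  N : ℕ
  N = n * n + n * L

  code : Item n L → Fin N
  code (inj₁ (u , v)) = combine u v ↑ˡ (n * L)
  code (inj₂ (v , l)) = (n * n) ↑ʳ combine v l

  decode : Fin N → Item n L
  decode i = [ (λ j → inj₁ (remQuot n j)) , (λ j → inj₂ (remQuot L j)) ]′ (splitAt (n * n) i)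

  decode-code : ∀ it → decode (code it) ≡ it
  decode-code (inj₁ (u , v)) rewrite Fin.splitAt-↑ˡ (n * n) (combine u v) (n * L) = cong inj₁ (Fin.remQuot-combine u v)
  decode-code (inj₂ (v , l)) rewrite Fin.splitAt-↑ʳ (n * n) (n * L) (combine v l) = cong inj₂ (Fin.remQuot-combine v l)

  code-↭ : ∀ {its its'} → map code its ↭ map code its' → its ↭ its'
  code-↭ {its} {its'} p = subst₂ _↭_ (decode-all its) (decode-all its') (Perm.map⁺ decode p)
    where
      decode-all : ∀ its → map decode (map code its) ≡ its
      decode-all its = trans (sym (List.map-∘ its)) (trans (List.map-cong decode-code its) (List.map-id its))

  weight : Vec (Fin 3) N → Item n L → ℕ
  weight x it = toℕ (lookup x (code it))

  fpᶦ : Vec (Fin 3) N → List (Item n L) → ℕ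
  fpᶦ x its = sum (map (weight x) its)

  fpᶦ≡fp : ∀ x its → fpᶦ x its ≡ fp x (map code its)
  fpᶦ≡fp x its = cong sum (List.map-∘ its)

  fpᶦ-++ : ∀ x its its' → fpᶦ x (its ++ its') ≡ fpᶦ x its + fpᶦ x its'
  fpᶦ-++ x its its' = trans (cong sum (List.map-++ (weight x) its its')) (sum-++ (map (weight x) its) _)

  fpᶦ-concatMap : ∀ {T : Set} x (f : T → List (Item n L)) ts → sum (map (fpᶦ x ∘ f) ts) ≡ fpᶦ x (concatMap f ts)
  fpᶦ-concatMap x f [] = refl
  fpᶦ-concatMap x f (t ∷ ts) = trans (cong (fpᶦ x (f t) +_) (fpᶦ-concatMap x f ts)) (sym (fpᶦ-++ x (f t) _))

  fpᶦ-≤ : ∀ x its → fpᶦ x its ≤ 2 * length its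
  fpᶦ-≤ x [] = z≤n
  fpᶦ-≤ x (it ∷ its) = ≤-trans (+-mono-≤ (≤-pred (Fin.toℕ<n (lookup x (code it)))) (fpᶦ-≤ x its))
                               (≤-reflexive (sym (*-suc 2 (length its))))

  -- A valid annotation has fingerprints at most B; counters saturate at C = B + 1.
  B C : ℕ
  B = 2 * (3 * m)
  C = suc B

  clip : ℕ → ℕ
  clip p = p ⊓ C

  clip-+ : ∀ p a → clip (clip p + a) ≡ clip (p + a)
  clip-+ p a with p ≤? C
  ... | yes p≤C rewrite m≤n⇒m⊓n≡m p≤C = refl
  ... | no p≰C rewrite m≥n⇒m⊓n≡n (≰⇒≥ p≰C) | m≥n⇒m⊓n≡n (m≤m+n C a)
                     | m≥n⇒m⊓n≡n (≤-trans (≰⇒≥ p≰C) (m≤m+n p a)) = refl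

  State : Set
  State = Mode n × ℕ × ℕ

  Accepting : State → Set
  Accepting (md , p , q) = Alive md × p ≡ q × p ≤ B

  accepting? : ∀ σ → Dec (Accepting σ)
  accepting? (md , p , q) = alive? md ×-dec (p ≟ q ×-dec p ≤? B)

  -- Saturation does not change the verdict.
  accepting-clip : ∀ md p q → Accepting (md , clip p , clip q) → Accepting (md , p , q)
  accepting-clip md p q (alive , same , small) =
    alive , trans (sym p-exact) (trans same q-exact) , ≤-trans (≤-reflexive (sym p-exact)) small
    where
      exact : ∀ {k} → clip k ≤ B → clip k ≡ k
      exact {k} small with k ≤? C
      ... | yes k≤C = m≤n⇒m⊓n≡m k≤C
      ... | no k≰C = ⊥-elim (1+n≰n (≤-trans (≤-reflexive (sym (m≥n⇒m⊓n≡n (≰⇒≥ k≰C)))) small))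
      p-exact = exact small
      q-exact = exact (subst (_≤ B) same small)

  clip-accepting : ∀ md p q → Accepting (md , p , q) → Accepting (md , clip p , clip q)
  clip-accepting md p .p (alive , refl , small) =
    alive , refl , subst (_≤ B) (sym (m≤n⇒m⊓n≡m (≤-trans small (n≤1+n B)))) small

  modeCode : Mode n → Fin (3 + n)
  modeCode dead = zero
  modeCode edges = suc zero
  modeCode (header nothing) = suc (suc zero)
  modeCode (header (just v)) = suc (suc (suc v))

  modeOf : Fin (3 + n) → Mode n
  modeOf zero = dead
  modeOf (suc zero) = edges
  modeOf (suc (suc zero)) = header nothing
  modeOf (suc (suc (suc v))) = header (just v)

  modeOf-code : ∀ md → modeOf (modeCode md) ≡ md
  modeOf-code dead = refl
  modeOf-code edges = refl
  modeOf-code (header nothing) = refl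
  modeOf-code (header (just v)) = refl

  S : ℕ
  S = (3 + n) * (suc C * suc C)

  counter : ℕ → Fin (suc C)
  counter p = fromℕ< (s≤s (m⊓n≤n p C))

  enc : State → Fin S
  enc (md , p , q) = combine (modeCode md) (combine (counter p) (counter q))

  counters : Fin (suc C * suc C) → ℕ × ℕ
  counters c = toℕ (proj₁ (remQuot {suc C} (suc C) c)) , toℕ (proj₂ (remQuot {suc C} (suc C) c))

  dec : Fin S → State
  dec s = modeOf (proj₁ (remQuot {3 + n} (suc C * suc C) s)) , counters (proj₂ (remQuot {3 + n} (suc C * suc C) s))

  toℕ-counter : ∀ p → toℕ (counter p) ≡ clip p
  toℕ-counter p = Fin.toℕ-fromℕ< (s≤s (m⊓n≤n p C))

  dec-enc : ∀ md p q → dec (enc (md , p , q)) ≡ (md , clip p , clip q)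
  dec-enc md p q =
    trans (cong (λ z → modeOf (proj₁ z) , counters (proj₂ z))
                (Fin.remQuot-combine (modeCode md) (combine (counter p) (counter q))))
          (cong₂ _,_ (modeOf-code md)
                     (trans (cong (λ z → toℕ (proj₁ z) , toℕ (proj₂ z))
                                  (Fin.remQuot-combine {suc C} {suc C} (counter p) (counter q)))
                            (cong₂ _,_ (toℕ-counter p) (toℕ-counter q))))

  enc-clip : ∀ md {p p' q q'} → clip p ≡ clip p' → clip q ≡ clip q' → enc (md , p , q) ≡ enc (md , p' , q')
  enc-clip md same-p same-q =
    cong₂ (λ a b → combine (modeCode md) (combine a b)) (counter-cong same-p) (counter-cong same-q)
    where
      counter-cong : ∀ {p p'} → clip p ≡ clip p' → counter p ≡ counter p'
      counter-cong {p} {p'} e = Fin.toℕ-injective (trans (toℕ-counter p) (trans e (sym (toℕ-counter p'))))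

  advance : (Mode n → Mode n) → ℕ → ℕ → State → State
  advance f a b (md , p , q) = f md , p + a , q + b

  enc-advance : ∀ f a b σ → enc (advance f a b (dec (enc σ))) ≡ enc (advance f a b σ)
  enc-advance f a b (md , p , q) =
    trans (cong (enc ∘ advance f a b) (dec-enc md p q)) (enc-clip (f md) (clip-+ p a) (clip-+ q b))

  randomness : Fin (3 ^ N) → Vec (Fin 3) N
  randomness = randVec 3 N

  start : State
  start = header nothing , 0 , 0

  edgeStep : Vec (Fin 3) N → State → Edge n → State
  edgeStep x σ e = advance id (weight x (inj₁ e)) 0 σ

  tokStep : Vec (Fin 3) N → State → Tok n L → State
  tokStep x σ t = advance (λ md → step md t) (fpᶦ x (posTok t)) (fpᶦ x (negTok t)) σ

  V : Verifier n L
  V = record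
    { S = S
    ; R = 3 ^ N
    ; init = λ _ → enc start
    ; stepA = λ r s e → enc (edgeStep (randomness r) (dec s) e)
    ; stepH = λ r s t → enc (tokStep (randomness r) (dec s) t)
    ; out = λ s → ⌊ accepting? (dec s) ⌋
    }

  edges-fold : ∀ x md p q A → foldl (edgeStep x) (md , p , q) A ≡ (md , p + sum (map (weight x ∘ inj₁) A) , q)
  edges-fold x md p q [] = cong (λ z → md , z , q) (sym (+-identityʳ p))
  edges-fold x md p q (e ∷ A) = trans (edges-fold x md (p + weight x (inj₁ e)) (q + 0) A)
    (cong₂ (λ a b → md , a , b) (+-assoc p (weight x (inj₁ e)) _) (+-identityʳ q))

  tokens-fold : ∀ x md p q h → foldl (tokStep x) (md , p , q) h ≡
    (run-mode md h , p + sum (map (fpᶦ x ∘ posTok) h) , q + sum (map (fpᶦ x ∘ negTok) h))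
  tokens-fold x md p q [] = cong₂ (λ a b → md , a , b) (sym (+-identityʳ p)) (sym (+-identityʳ q))
  tokens-fold x md p q (t ∷ h) = trans (tokens-fold x (step md t) (p + fpᶦ x (posTok t)) (q + fpᶦ x (negTok t)) h)
    (cong₂ (λ a b → run-mode (step md t) h , a , b) (+-assoc p (fpᶦ x (posTok t)) _) (+-assoc q (fpᶦ x (negTok t)) _))

  final : Vec (Fin 3) N → List (Edge n) → List (Tok n L) → State
  final x A h = run-mode (header nothing) h , fpᶦ x (claimed A h) , fpᶦ x (witnessed h)

  abstract-run : ∀ x A h → foldl (tokStep x) (foldl (edgeStep x) start A) h ≡ final x A h
  abstract-run x A h rewrite edges-fold x (header nothing) 0 0 A =
    trans (tokens-fold x (header nothing) _ 0 h)
          (cong₂ (λ a b → run-mode (header nothing) h , a , b)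
                 (trans (cong₂ _+_ (cong sum (List.map-∘ A)) (fpᶦ-concatMap x posTok h))
                        (sym (fpᶦ-++ x (map inj₁ A) _)))
                 (fpᶦ-concatMap x negTok h))

  run-V : ∀ r A h → run V r A h ≡ ⌊ accepting? (dec (enc (final (randomness r) A h))) ⌋
  run-V r A h = cong (λ s → ⌊ accepting? (dec s) ⌋) (begin
    foldl stepH (foldl stepA (enc start) A) h        ≡⟨ cong (λ s → foldl stepH s h) (simulate enc dec (edgeStep x) faithfulA start A) ⟩
    foldl stepH (enc (foldl (edgeStep x) start A)) h ≡⟨ simulate enc dec (tokStep x) faithfulH _ h ⟩
    enc (foldl (tokStep x) (foldl (edgeStep x) start A) h) ≡⟨ cong enc (abstract-run x A h) ⟩
    enc (final x A h)                                ∎)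
    where
      open ≡-Reasoning
      x = randomness r
      stepA = λ s e → enc (edgeStep x (dec s) e)
      stepH = λ s t → enc (tokStep x (dec s) t)
      faithfulA = λ σ e → enc-advance id (weight x (inj₁ e)) 0 σ
      faithfulH = λ σ t → enc-advance (λ md → step md t) (fpᶦ x (posTok t)) (fpᶦ x (negTok t)) σ

  acceptCount-V : ∀ A h → acceptCount V A h ≡ ∑ (λ r → 𝟙[ accepting? (final (randomness r) A h) ])
  acceptCount-V A h =
    trans (cong sum (List.map-tabulate {n = 3 ^ N} id (λ r → if run V r A h then 1 else 0)))
          (∑-cong λ r → trans (cong (λ b → if b then 1 else 0) (run-V r A h)) (exact (final (randomness r) A h)))
    where
      exact : ∀ σ → 𝟙[ accepting? (dec (enc σ)) ] ≡ 𝟙[ accepting? σ ]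
      exact (md , p , q) = trans (cong (λ σ → 𝟙[ accepting? σ ]) (dec-enc md p q))
                                 (𝟙-cong (accepting? _) (accepting? _) (accepting-clip md p q) (clip-accepting md p q))

  complete : ∀ A → length A ≡ m → ∀ h → ValidLabelAug A h → acceptCount V A h ≡ 3 ^ N
  complete A |A|≡m h valid@(hdr , E' , refl , _ , _ , _ , _ , E'↭A) =
    trans (acceptCount-V A h)
          (trans (∑-cong λ r → 𝟙-yes (accepting? _) (accepts (randomness r)))
                 (trans (∑-const (3 ^ N) 1) (*-identityʳ (3 ^ N))))
    where
      well-formed = proj₁ (valid⇒balanced A h valid)
      balanced = proj₂ (valid⇒balanced A h valid)
      size : length (claimed A h) ≡ 3 * m
      size = trans (Perm.↭-length balanced) (trans (length-witnessed hdr E')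
               (cong (3 *_) (trans (sym (List.length-map plainEdge E')) (trans (Perm.↭-length E'↭A) |A|≡m))))
      accepts : ∀ x → Accepting (final x A h)
      accepts x = wellFormed⇒alive h well-formed , sum-↭ (Perm.map⁺ (weight x) balanced) ,
                  ≤-trans (fpᶦ-≤ x (claimed A h)) (≤-reflexive (cong (2 *_) size))

  sound : ∀ A h → ¬ ValidLabelAug A h → 3 * acceptCount V A h ≤ 3 ^ N
  sound A h invalid =
    subst (λ k → 3 * k ≤ 3 ^ N) (sym (acceptCount-V A h)) (by-mode (alive? (run-mode (header nothing) h)))
    where
      accepted : Fin (3 ^ N) → ℕ
      accepted r = 𝟙[ accepting? (final (randomness r) A h) ]
      by-mode : Dec (Alive (run-mode (header nothing) h)) → 3 * ∑ accepted ≤ 3 ^ N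
      by-mode (no rejected) = subst (λ k → 3 * k ≤ 3 ^ N) (sym never) z≤n
        where
          never : ∑ accepted ≡ 0
          never = trans (∑-cong λ r → 𝟙-no (accepting? (final (randomness r) A h)) (rejected ∘ proj₁))
                        (trans (∑-const (3 ^ N) 0) (*-zeroʳ (3 ^ N)))
      -- a well-formed invalid annotation is unbalanced, so its fingerprints rarely collide
      by-mode (yes alive) = ≤-trans (*-monoʳ-≤ 3 (∑-mono λ r → 𝟙-mono (accepting? _) (_ ≟ _) (collide (randomness r))))
                                    (fp-collisions 3 N (map code (claimed A h)) (map code (witnessed h)) unbalanced)
        where
          collide : ∀ x → Accepting (final x A h) → fp x (map code (claimed A h)) ≡ fp x (map code (witnessed h))
          collide x (_ , same , _) = trans (sym (fpᶦ≡fp x (claimed A h))) (trans same (fpᶦ≡fp x (witnessed h)))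
          unbalanced : ¬ (map code (claimed A h) ↭ map code (witnessed h))
          unbalanced p = invalid (balanced⇒valid A h (alive⇒wellFormed h alive) (code-↭ p))

*-≤-^ : ∀ W {a b} i j → a ≤ W ^ i → b ≤ W ^ j → a * b ≤ W ^ (i + j)
*-≤-^ W i j a≤ b≤ = ≤-trans (*-mono-≤ a≤ b≤) (≤-reflexive (sym (^-distribˡ-+-* W i j)))

state-bound : ∀ n m L → Protocol.S n m L ≤ wordRange n m L ^ 10
state-bound n m L = *-≤-^ W 2 8 modes (*-≤-^ W 4 4 counter counter)
  where
    W = wordRange n m L
    2+n≤W : 2 + n ≤ W
    2+n≤W = ≤-trans (m≤m+n (2 + n) m) (m≤m+n (2 + n + m) L)
    2≤W : 2 ≤ W
    2≤W = ≤-trans (m≤m+n 2 n) 2+n≤W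
    m≤W : m ≤ W
    m≤W = ≤-trans (m≤n+m m (2 + n)) (m≤m+n (2 + n + m) L)
    -- 3 + n ≤ W + W ≤ W * W
    modes : 3 + n ≤ W ^ 2
    modes = ≤-trans (+-mono-≤ (≤-trans (s≤s z≤n) 2≤W) 2+n≤W)
                    (≤-trans (≤-reflexive (cong (W +_) (sym (+-identityʳ W))))
                             (≤-trans (*-monoˡ-≤ W 2≤W) (≤-reflexive (cong (W *_) (sym (*-identityʳ W))))))
    -- 2 + 2 * (3 * m) ≤ 7 * W ≤ W ^ 3 * W
    counter : 2 + 2 * (3 * m) ≤ W ^ 4
    counter = ≤-trans (+-mono-≤ 2≤W (*-monoʳ-≤ 2 (*-monoʳ-≤ 3 m≤W)))
                (≤-trans (≤-reflexive (seven W))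
                         (≤-trans (*-monoˡ-≤ W (≤-trans (n≤1+n 7) (^-monoˡ-≤ 3 2≤W)))
                                  (≤-reflexive (*-comm (W ^ 3) W))))
      where
        seven : ∀ w → w + 2 * (3 * w) ≡ 7 * w
        seven = solve-∀

lemma1 : Σ ℕ λ c → (n m L : ℕ) → Σ (Verifier n L) λ V →
    (Verifier.S V ≤ wordRange n m L ^ c)
    × (1 ≤ Verifier.R V)
    × ((A : List (Edge n)) → length A ≡ m → (h : List (Tok n L)) →
    (ValidLabelAug A h → acceptCount V A h ≡ Verifier.R V)
    × (¬ ValidLabelAug A h → 3 * acceptCount V A h ≤ Verifier.R V))
lemma1 = 10 , λ n m L → let open Protocol n m L in
  V , state-bound n m L , >-nonZero⁻¹ (3 ^ N) {{m^n≢0 3 N}} ,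
  λ A |A|≡m h → complete A |A|≡m h , sound A h
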